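{- Every finite bipartite graph of girth $6$ is not locatable.
   Context: The Robber Locating game on a finite connected graph $G$: a robber occupies an (initially unknown) vertex of $G$. The game proceeds in rounds; in each round the robber first either stays at his current vertex or moves to an adjacent vertex, and then the cop probes (chooses) any vertex $v$ of $G$ and is told the current graph distance from $v$ to the robber. There is no further restriction on the robber's moves. The cop wins if at some point she can determine the robber's current vertex uniquely from the information received. The robber is omniscient. A graph is locatable if the cop has a strategy guaranteed to win within a bounded number of rounds, equivalently a strategy that wins against every robber behaviour. -}

module Defs where

open import Data.Nat using (ℕ; zero; suc; _<_; _≤_)
open import Data.Fin using (Fin)
open import Data.Bool using (Bool)
open import Data.List using (List; []; _∷_)
open import Data.Product using (Σ; ∃; _×_)
open import Data.Sum using (_⊎_)
open import Relation.Nullary using (¬_)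
open import Relation.Binary.PropositionalEquality using (_≡_; _≢_)

record Graph : Set₁ where
  field
    n     : ℕ
    Adj   : Fin n → Fin n → Set
    sym   : ∀ {u v} → Adj u v → Adj v u
    irrefl : ∀ {u} → ¬ Adj u u
open Graph public

data WalkLen (G : Graph) : Fin (n G) → Fin (n G) → ℕ → Set where
  here : ∀ {u} → WalkLen G u u zero
  step : ∀ {u w v k} → Adj G u w → WalkLen G w v k → WalkLen G u v (suc k)

Connected : Graph → Set
Connected G = ∀ u v → ∃ λ k → WalkLen G u v k

Dist : (G : Graph) → Fin (n G) → Fin (n G) → ℕ → Set
Dist G u v d = WalkLen G u v d × (∀ k → k < d → ¬ WalkLen G u v k)

Bipartite : Graph → Set
Bipartite G = Σ (Fin (n G) → Bool) λ col → ∀ u v → Adj G u v → col u ≢ col v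

HasCycleOfLength : Graph → ℕ → Set
HasCycleOfLength G k =
  Σ (ℕ → Fin (n G)) λ c →
    3 ≤ k
    × (∀ i → i < k → Adj G (c i) (c (suc i)))
    × c k ≡ c zero
    × (∀ i j → i < k → j < k → c i ≡ c j → i ≡ j)

Girth : Graph → ℕ → Set
Girth G g = HasCycleOfLength G g × (∀ k → HasCycleOfLength G k → g ≤ k)

-- The Robber Locating game.
-- Robber positions: p : ℕ → Fin n, p 0 is the initial (unknown) position,
-- p (suc j) the position in round suc j after the robber's move.
RobberWalk : (G : Graph) → (ℕ → Fin (n G)) → Set
RobberWalk G p = ∀ i → p (suc i) ≡ p i ⊎ Adj G (p i) (p (suc i))

-- Answers: a (suc j) is the answer received in round suc j (a 0 unused).
-- hist a j = answers of rounds 1..j (most recent first).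
hist : (ℕ → ℕ) → ℕ → List ℕ
hist a zero = []
hist a (suc j) = a (suc j) ∷ hist a j

-- A (deterministic) cop strategy: the probe of the next round as a
-- function of all answers received so far.
Strategy : Graph → Set
Strategy G = List ℕ → Fin (n G)

ConsistentUpTo : (G : Graph) → Strategy G → (ℕ → Fin (n G)) → (ℕ → ℕ) → ℕ → Set
ConsistentUpTo G σ p a t = ∀ j → j < t → Dist G (σ (hist a j)) (p (suc j)) (a (suc j))

ConsistentForever : (G : Graph) → Strategy G → (ℕ → Fin (n G)) → (ℕ → ℕ) → Set
ConsistentForever G σ p a = ∀ j → Dist G (σ (hist a j)) (p (suc j)) (a (suc j))

Determined : (G : Graph) → Strategy G → (ℕ → Fin (n G)) → (ℕ → ℕ) → ℕ → Set
Determined G σ p a t =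
  ∀ q → RobberWalk G q → ConsistentUpTo G σ q a t → q t ≡ p t

Locatable : Graph → Set
Locatable G =
  Σ (Strategy G) λ σ → Σ ℕ λ N →
    ∀ p a → RobberWalk G p → ConsistentForever G σ p a →
      Σ ℕ λ t → t ≤ N × Determined G σ p a t

module Submission where

-- Let corner 0 , … , corner 5 be a hexagon.  In a bipartite graph
-- the distances from any probe v to two adjacent vertices differ by exactly
-- one, so around the hexagon the distances to v form a closed ±1 walk of
-- length six.  Such a walk cannot take four steps in the same direction, and
-- a short case analysis ('closed-hexagon') shows: whatever v is, a robber at
-- corner i can stay, step forward or step back to some corner i' such that
-- corner i' and corner (i' + 2) are equidistant from v ('equidistant-move').
-- Two robbers kept two corners apart, both following this rule, are legal
-- robber walks receiving identical answers against every cop strategy, so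
-- the cop can never tell them apart.

open import Defs
open import Data.Nat using (ℕ; zero; suc; _+_; _<_; _≤_)
open import Data.Nat.Properties using (≤-antisym; ≮⇒≥; <-cmp; ≤-refl; +-comm)
open import Data.Nat.Induction using (<-rec)
open import Data.Nat.GeneralisedArithmetic using (iterate)
open import Data.Fin using (Fin; toℕ) renaming (zero to fz; suc to fs)
open import Data.Fin.Properties using (toℕ<n)
open import Data.Bool using (not)
open import Data.Bool.Properties using (¬-not)
open import Data.List using (List; []; _∷_)
open import Data.Product using (Σ; ∃; _×_; _,_; proj₁; proj₂)
open import Data.Sum using (_⊎_; inj₁; inj₂; swap)
open import Function using (_∘_)
open import Relation.Binary using (tri<; tri≈; tri>)
open import Relation.Binary.PropositionalEquality
  using (_≡_; _≢_; refl; trans; cong; subst; subst₂) renaming (sym to ≡-sym)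
open import Relation.Nullary using (¬_; yes; no; contradiction)
open import Relation.Nullary.Decidable using (¬¬-excluded-middle)

Step : ℕ → ℕ → Set
Step x y = suc x ≡ y ⊎ suc y ≡ x

no-return-after-four-ups : ∀ {m e} → Step (4 + m) e → ¬ Step e m
no-return-after-four-ups (inj₁ refl) (inj₁ ())
no-return-after-four-ups (inj₁ refl) (inj₂ ())
no-return-after-four-ups (inj₂ refl) (inj₁ ())
no-return-after-four-ups (inj₂ refl) (inj₂ ())

-- Otherwise the four steps m→a→b→c→d all go the same way.
closed-hexagon : ∀ {m a b c d e} →
  Step m a → Step a b → Step b c → Step c d → Step d e → Step e m →
  a ≡ c ⊎ m ≡ b ⊎ b ≡ d
closed-hexagon _ (inj₁ refl) (inj₂ refl) _ _ _ = inj₁ refl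
closed-hexagon _ (inj₂ refl) (inj₁ refl) _ _ _ = inj₁ refl
closed-hexagon (inj₂ refl) (inj₁ refl) (inj₁ refl) _ _ _ = inj₂ (inj₁ refl)
closed-hexagon (inj₁ refl) (inj₂ refl) (inj₂ refl) _ _ _ = inj₂ (inj₁ refl)
closed-hexagon _ (inj₁ refl) (inj₁ refl) (inj₂ refl) _ _ = inj₂ (inj₂ refl)
closed-hexagon _ (inj₂ refl) (inj₂ refl) (inj₁ refl) _ _ = inj₂ (inj₂ refl)
closed-hexagon (inj₁ refl) (inj₁ refl) (inj₁ refl) (inj₁ refl) de em =
  contradiction em (no-return-after-four-ups de)
closed-hexagon (inj₂ refl) (inj₂ refl) (inj₂ refl) (inj₂ refl) de em =
  contradiction (swap de) (no-return-after-four-ups (swap em))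

rot : Fin 6 → Fin 6
rot fz = fs fz
rot (fs fz) = fs (fs fz)
rot (fs (fs fz)) = fs (fs (fs fz))
rot (fs (fs (fs fz))) = fs (fs (fs (fs fz)))
rot (fs (fs (fs (fs fz)))) = fs (fs (fs (fs (fs fz))))
rot (fs (fs (fs (fs (fs fz))))) = fz

shift : ℕ → Fin 6 → Fin 6
shift zero i = i
shift (suc k) i = rot (shift k i)

shift-+ : ∀ k l i → shift (k + l) i ≡ shift k (shift l i)
shift-+ zero l i = refl
shift-+ (suc k) l i = cong rot (shift-+ k l i)

shift-comm : ∀ k l i → shift k (shift l i) ≡ shift l (shift k i)
shift-comm k l i =
  trans (≡-sym (shift-+ k l i)) (trans (cong (λ s → shift s i) (+-comm k l)) (shift-+ l k i))

shift-6 : ∀ i → shift 6 i ≡ i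
shift-6 fz = refl
shift-6 (fs fz) = refl
shift-6 (fs (fs fz)) = refl
shift-6 (fs (fs (fs fz))) = refl
shift-6 (fs (fs (fs (fs fz)))) = refl
shift-6 (fs (fs (fs (fs (fs fz))))) = refl

data Move : ℕ → Set where
  stay : Move 0
  forward : Move 1
  back : Move 5

-- If d changes by exactly one along each edge of the hexagon, then from every
-- corner i some robber move leads to a corner i' with d i' ≡ d (i' + 2).
-- (This is 'closed-hexagon' read off around the corners i - 1 , … , i + 4.)
equidistant-move : (d : Fin 6 → ℕ) → (∀ i → Step (d i) (d (rot i))) →
  ∀ i → Σ ℕ λ s → Move s × d (shift s i) ≡ d (shift 2 (shift s i))
equidistant-move d around i
  with closed-hexagon (subst (λ j → Step (d (shift 5 i)) (d j)) (shift-6 i) (around (shift 5 i)))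
         (around i) (around (rot i)) (around (shift 2 i)) (around (shift 3 i)) (around (shift 4 i))
... | inj₁ eq = 0 , stay , eq
... | inj₂ (inj₁ eq) = 5 , back , trans eq (cong (λ j → d (rot j)) (≡-sym (shift-6 i)))
... | inj₂ (inj₂ eq) = 1 , forward , eq

DistanceFunction : Graph → Set
DistanceFunction G = ∀ u v → Σ ℕ (Dist G u v)

snoc : ∀ {G u v w k} → WalkLen G u v k → Adj G v w → WalkLen G u w (suc k)
snoc here e = step e here
snoc (step e' walk) e = step e' (snoc walk e)

walk-colour : ∀ {G} ((col , proper) : Bipartite G) {u v k} →
  WalkLen G u v k → col v ≡ iterate not (col u) k
walk-colour _ here = refl
walk-colour (col , proper) {u} (step {w = w} {k = k} e walk) =
  trans (walk-colour (col , proper) walk)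
        (cong (λ b → iterate not b k) (¬-not (λ eq → proper u w e (≡-sym eq))))

module Distances (G : Graph) (D : DistanceFunction G) where

  dist : Fin (n G) → Fin (n G) → ℕ
  dist u v = proj₁ (D u v)

  shortest-walk : ∀ u v → WalkLen G u v (dist u v)
  shortest-walk u v = proj₁ (proj₂ (D u v))

  dist-edge-≤ : ∀ v {x y} → Adj G x y → dist v y ≤ suc (dist v x)
  dist-edge-≤ v {x} {y} e =
    ≮⇒≥ λ lt → proj₂ (proj₂ (D v y)) _ lt (snoc (shortest-walk v x) e)

  -- In a bipartite graph adjacent vertices have different distances from v,
  -- because walks of equal length from v end in vertices of equal colour.
  dist-edge-≢ : Bipartite G → ∀ v {x y} → Adj G x y → dist v x ≢ dist v y
  dist-edge-≢ (col , proper) v {x} {y} e eq = proper x y e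
    (trans (walk-colour (col , proper) (shortest-walk v x))
      (trans (cong (iterate not (col v)) eq)
             (≡-sym (walk-colour (col , proper) (shortest-walk v y)))))

  dist-edge-step : Bipartite G → ∀ v {x y} → Adj G x y → Step (dist v x) (dist v y)
  dist-edge-step bip v {x} {y} e with <-cmp (dist v x) (dist v y)
  ... | tri< lt _ _ = inj₁ (≤-antisym lt (dist-edge-≤ v e))
  ... | tri≈ _ eq _ = contradiction eq (dist-edge-≢ bip v e)
  ... | tri> _ _ gt = inj₂ (≤-antisym gt (dist-edge-≤ v (Graph.sym G e)))

record Hexagon (G : Graph) : Set where
  field
    corner : Fin 6 → Fin (n G)
    edge : ∀ i → Adj G (corner i) (corner (rot i))
    apart : ∀ i → corner i ≢ corner (shift 2 i)

hexagon-of-cycle : ∀ {G} → HasCycleOfLength G 6 → Hexagon G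
hexagon-of-cycle {G} (c , _ , adj , closed , injective) = record
  { corner = λ i → c (toℕ i)
  ; edge = edge
  ; apart = λ i eq → two-apart i (injective _ _ (toℕ<n i) (toℕ<n (shift 2 i)) eq)
  }
  where
  edge : ∀ i → Adj G (c (toℕ i)) (c (toℕ (rot i)))
  edge i@fz = adj _ (toℕ<n i)
  edge i@(fs fz) = adj _ (toℕ<n i)
  edge i@(fs (fs fz)) = adj _ (toℕ<n i)
  edge i@(fs (fs (fs fz))) = adj _ (toℕ<n i)
  edge i@(fs (fs (fs (fs fz)))) = adj _ (toℕ<n i)
  edge (fs (fs (fs (fs (fs fz))))) = subst (Adj G (c 5)) closed (adj 5 ≤-refl)

  two-apart : ∀ i → toℕ i ≢ toℕ (shift 2 i)
  two-apart fz ()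
  two-apart (fs fz) ()
  two-apart (fs (fs fz)) ()
  two-apart (fs (fs (fs fz))) ()
  two-apart (fs (fs (fs (fs fz)))) ()
  two-apart (fs (fs (fs (fs (fs fz))))) ()

move-along : ∀ {G} (H : Hexagon G) {s} → Move s → ∀ j →
  let open Hexagon H in
  corner (shift s j) ≡ corner j ⊎ Adj G (corner j) (corner (shift s j))
move-along H stay j = inj₁ refl
move-along H forward j = inj₂ (Hexagon.edge H j)
move-along {G} H back j = inj₂ (Graph.sym G
  (subst (λ k → Adj G (corner (shift 5 j)) (corner k)) (shift-6 j) (edge (shift 5 j))))
  where open Hexagon H

-- Against a fixed cop strategy σ, a robber starting at corner 0 answers every
-- probe with the move given by 'equidistant-move'; its twin copies every move
-- two corners ahead and receives the same answers.
module Evasion {G : Graph} (bip : Bipartite G) (D : DistanceFunction G)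
               (H : Hexagon G) (σ : Strategy G) where
  open Distances G D
  open Hexagon H

  evade : ∀ v i → Σ ℕ λ s → Move s ×
    dist v (corner (shift s i)) ≡ dist v (corner (shift 2 (shift s i)))
  evade v = equidistant-move (λ i → dist v (corner i)) (λ i → dist-edge-step bip v (edge i))

  State : Set
  State = Fin 6 × List ℕ

  moved : State → Fin 6
  moved (i , answers) = shift (proj₁ (evade (σ answers) i)) i

  next : State → State
  next (i , answers) = moved (i , answers) , dist (σ answers) (corner (moved (i , answers))) ∷ answers

  state : ℕ → State
  state zero = fz , []
  state (suc j) = next (state j)

  position : ℕ → Fin 6
  position j = proj₁ (state j)

  answer : ℕ → ℕ
  answer zero = 0
  answer (suc j) = dist (σ (proj₂ (state j))) (corner (position (suc j)))

  history-answer : ∀ j → hist answer j ≡ proj₂ (state j)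
  history-answer zero = refl
  history-answer (suc j) = cong (answer (suc j) ∷_) (history-answer j)

  -- The robber shifted by k corners; robber 0 is the robber, robber 2 the twin.
  robber : ℕ → ℕ → Fin (n G)
  robber k j = corner (shift k (position j))

  robber-walk : ∀ k → RobberWalk G (robber k)
  robber-walk k j =
    subst (λ c → corner c ≡ corner i ⊎ Adj G (corner i) (corner c))
          (shift-comm s k (position j))
          (move-along H move i)
    where
    s = proj₁ (evade (σ (proj₂ (state j))) (position j))
    move = proj₁ (proj₂ (evade (σ (proj₂ (state j))) (position j)))
    i = shift k (position j)

  consistent-at : ∀ j u → dist (σ (proj₂ (state j))) u ≡ answer (suc j) →
    Dist G (σ (hist answer j)) u (answer (suc j))
  consistent-at j u eq =
    subst₂ (λ answers d → Dist G (σ answers) u d) (≡-sym (history-answer j)) eq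
      (proj₂ (D (σ (proj₂ (state j))) u))

  robber-consistent : ConsistentForever G σ (robber 0) answer
  robber-consistent j = consistent-at j (robber 0 (suc j)) refl

  twin-consistent : ConsistentForever G σ (robber 2) answer
  twin-consistent j = consistent-at j (robber 2 (suc j))
    (≡-sym (proj₂ (proj₂ (evade (σ (proj₂ (state j))) (position j)))))

  -- The answers never determine the robber's corner: its twin is elsewhere.
  never-determined : ∀ t → ¬ Determined G σ (robber 0) answer t
  never-determined t determined =
    apart (position t) (≡-sym (determined (robber 2) (robber-walk 2) (λ j _ → twin-consistent j)))

bipartite-hexagon-not-locatable : ∀ {G} → Bipartite G → Hexagon G →
  DistanceFunction G → ¬ Locatable G
bipartite-hexagon-not-locatable bip H D (σ , N , wins) =
  never-determined _ (proj₂ (proj₂ (wins (robber 0) answer (robber-walk 0) robber-consistent)))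
  where open Evasion bip D H σ

-- d is the least natural number satisfying P ('Dist G u v' is
-- 'LeastWitness (WalkLen G u v)').
LeastWitness : (ℕ → Set) → ℕ → Set
LeastWitness P d = P d × (∀ j → j < d → ¬ P j)

least-witness : {P : ℕ → Set} → ∀ k → P k → ¬ ¬ Σ ℕ (LeastWitness P)
least-witness {P} = <-rec (λ k → P k → ¬ ¬ Σ ℕ (LeastWitness P)) below
  where
  below : ∀ k → (∀ {j} → j < k → P j → ¬ ¬ Σ ℕ (LeastWitness P)) →
    P k → ¬ ¬ Σ ℕ (LeastWitness P)
  below k smaller pk none = ¬¬-excluded-middle {A = ∃ λ j → j < k × P j} λ
    { (yes (j , j<k , pj)) → smaller j<k pj none
    ; (no nothing-smaller) → none (k , pk , λ j j<k pj → nothing-smaller (j , j<k , pj)) }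

¬¬-finite-choice : ∀ {m} {P : Fin m → Set} → (∀ i → ¬ ¬ P i) → ¬ ¬ (∀ i → P i)
¬¬-finite-choice {zero} each none = none λ ()
¬¬-finite-choice {suc m} {P} each none =
  each fz λ p0 → ¬¬-finite-choice {m} {P ∘ fs} (each ∘ fs) λ ps →
    none λ { fz → p0 ; (fs i) → ps i }

¬¬-distance-function : ∀ {G} → Connected G → ¬ ¬ DistanceFunction G
¬¬-distance-function connected =
  ¬¬-finite-choice λ u → ¬¬-finite-choice λ v →
    least-witness (proj₁ (connected u v)) (proj₂ (connected u v))

mainTheorem2 : (G : Graph) → Connected G → Bipartite G → Girth G 6 → ¬ Locatable G
mainTheorem2 G connected bipartite (hexagon , _) locatable =
  ¬¬-distance-function connected λ D →
    bipartite-hexagon-not-locatable bipartite (hexagon-of-cycle hexagon) D locatable
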